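{- Let $W\ge 1$ be an integer and $0<\varepsilon<1$ be such that $W\varepsilon^{ -1}=2^L$ for an integer $L$. Consider a window consisting of the last $W$ items of a stream over a universe of IDs, let $D$ be the number of distinct IDs in the window, and let $h$ be a random fingerprint function mapping IDs to $\{0,1,\dots,2^L-1\}$ such that the fingerprints of distinct IDs are independent and uniformly distributed. Let $Z=|\{h(y): y \text{ appears in the window}\}|$. Then $$D^2-\frac{4D^3}{3\cdot 2^L}<\mathbb{E}(Z^2)<D^2+\frac{D^3}{3\cdot 2^L}.$$ -}

module Defs where

open import Data.Nat using (ℕ; zero; suc; _+_; _*_; _^_; _<_)
open import Data.Nat.Properties using (m^n≢0; _≟_)
open import Data.List using (List; []; _∷_; length; map; upTo; concatMap; deduplicate)
open import Data.Nat.ListAction using (sum)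
open import Data.Vec using (Vec; toList)
open import Data.Bool using (if_then_else_)
open import Relation.Nullary.Decidable using (⌊_⌋)
open import Data.Integer using (+_)
open import Data.Rational using (ℚ; _/_)

distinctCount : List ℕ → ℕ
distinctCount xs = length (deduplicate _≟_ xs)

distinctIds : ∀ {W} → Vec ℕ W → List ℕ
distinctIds w = deduplicate _≟_ (toList w)

D : ∀ {W} → Vec ℕ W → ℕ
D w = length (distinctIds w)

-- All assignments of fingerprints in {0,…,N-1} to d (distinct) IDs,
-- as lists of length d; there are exactly N^d of them, each listed once.
assignments : ℕ → ℕ → List (List ℕ)
assignments zero    N = [] ∷ []
assignments (suc d) N = concatMap (λ v → map (v ∷_) (assignments d N)) (upTo N)

-- Fingerprint function determined by assigning the i-th value of `a`
-- to the i-th ID of `ids` (IDs not in `ids` get 0; they never matter).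
fingerprint : List ℕ → List ℕ → ℕ → ℕ
fingerprint []         _        y = 0
fingerprint (x ∷ ids)  []       y = 0
fingerprint (x ∷ ids)  (v ∷ a)  y = if ⌊ x ≟ y ⌋ then v else fingerprint ids a y

Z : ∀ {W} → Vec ℕ W → List ℕ → ℕ
Z w a = distinctCount (map (fingerprint (distinctIds w) a) (toList w))

-- E(Z²) for a uniformly random fingerprint function into {0,…,2^L - 1}
-- (independent uniform fingerprints of the D distinct IDs):
-- the average of Z² over all (2^L)^D equally likely assignments.
EZ² : ∀ {W} → ℕ → Vec ℕ W → ℚ
EZ² L w = ((+ sum (map (λ a → Z w a ^ 2) (assignments (D w) (2 ^ L))))
            / ((2 ^ L) ^ D w)) {{m^n≢0 (2 ^ L) (D w) {{m^n≢0 2 L}}}}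

_over2^_ : ℕ → ℕ → ℚ
n over2^ L = ((+ n) / (2 ^ L)) {{m^n≢0 2 L}}

-- Write d = D and N = 2^L. Under a fingerprint assignment the window shows at most d
-- fingerprints, and at least d − c of them, where c is the number of colliding pairs of
-- the assignment; hence d² − 2dc ≤ Z² ≤ d². Averaging over all N^d assignments, the
-- colliding pairs number at most d(d − 1)/(2N) on average, so
-- d² − d²(d − 1)/N ≤ E(Z²) ≤ d², which lies strictly inside the stated bounds as d ≥ 1.
module Submission where

module Counting where

  open import Defs
  open import Data.Nat
  open import Data.Nat.Properties
  open import Data.Nat.ListAction using (sum)
  open import Data.Nat.ListAction.Properties using (sum-++)
  open import Data.Nat.Tactic.RingSolver using (solve-∀)
  open import Data.Bool using (if_then_else_)
  open import Data.List using (List; []; _∷_; _++_; length; map; upTo; concatMap; removeAt)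
  open import Data.List.Properties using (length-map; length-upTo; length-removeAt′; filter-all; map-++)
  open import Data.List.Relation.Unary.All as All using (All; []; _∷_)
  open import Data.List.Relation.Unary.All.Properties using (concat⁺; map⁺)
  open import Data.List.Relation.Unary.AllPairs using ([]; _∷_)
  open import Data.List.Relation.Unary.Any using (here; there; index)
  open import Data.List.Relation.Unary.Unique.Propositional using (Unique)
  open import Data.List.Relation.Unary.Unique.Propositional.Properties using (upTo⁺)
  open import Data.List.Relation.Unary.Unique.DecPropositional.Properties using (deduplicate-!)
  open import Data.List.Membership.Propositional using (_∈_; _∉_)
  open import Data.List.Membership.Propositional.Properties using (∈-deduplicate⁺; ∈-deduplicate⁻; ∈-map⁺)
  open import Data.List.Membership.DecPropositional _≟_ using (_∈?_)
  open import Data.List.Relation.Binary.Subset.Propositional using (_⊆_)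
  import Data.List.Relation.Binary.Subset.Propositional.Properties as ⊆
  open import Data.Vec using (Vec; toList)
  open import Data.Product using (∃; _×_; _,_)
  open import Function using (_∘_)
  open import Relation.Nullary using (yes; no; ¬?; does)
  open import Relation.Nullary.Decidable using (dec-true; dec-false)
  open import Data.Empty using (⊥-elim)
  open import Relation.Binary.PropositionalEquality

  private variable A B : Set

  ∈-removeAt : ∀ {x y : A} {ys} (x∈ys : x ∈ ys) → y ∈ ys → x ≢ y →
               y ∈ removeAt ys (index x∈ys)
  ∈-removeAt (here refl)  (here refl)  x≢y = ⊥-elim (x≢y refl)
  ∈-removeAt (here refl)  (there y∈ys) _   = y∈ys
  ∈-removeAt (there _)    (here refl)  _   = here refl
  ∈-removeAt (there x∈ys) (there y∈ys) x≢y = there (∈-removeAt x∈ys y∈ys x≢y)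

  unique-length-≤ : ∀ {xs ys : List A} → Unique xs → xs ⊆ ys → length xs ≤ length ys
  unique-length-≤ {xs = []}     _               _     = z≤n
  unique-length-≤ {xs = x ∷ xs} {ys} (x∉xs ∷ xs!) xs⊆ys =
    subst (suc (length xs) ≤_) (sym (length-removeAt′ ys (index x∈ys)))
      (s≤s (unique-length-≤ xs! λ y∈xs → ∈-removeAt x∈ys (xs⊆ys (there y∈xs)) (All.lookup x∉xs y∈xs)))
    where
    x∈ys : x ∈ ys
    x∈ys = xs⊆ys (here refl)

  distinctCount-mono : ∀ {xs ys} → xs ⊆ ys → distinctCount xs ≤ distinctCount ys
  distinctCount-mono {xs} xs⊆ys = unique-length-≤ (deduplicate-! _≟_ xs)
    (∈-deduplicate⁺ _≟_ ∘ xs⊆ys ∘ ∈-deduplicate⁻ _≟_ xs)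

  distinctCount≤length : ∀ xs → distinctCount xs ≤ length xs
  distinctCount≤length xs = unique-length-≤ (deduplicate-! _≟_ xs) (∈-deduplicate⁻ _≟_ xs)

  distinctCount-∷-∉ : ∀ {x xs} → x ∉ xs → distinctCount (x ∷ xs) ≡ suc (distinctCount xs)
  distinctCount-∷-∉ {x} {xs} x∉xs = cong (suc ∘ length) (filter-all (¬? ∘ (x ≟_))
    (All.tabulate λ y∈ x≡y → x∉xs (subst (_∈ xs) (sym x≡y) (∈-deduplicate⁻ _≟_ xs y∈))))

  ∑ : List A → (A → ℕ) → ℕ
  ∑ xs f = sum (map f xs)

  infix 6.5 ∑
  syntax ∑ xs (λ x → e) = ∑[ x ← xs ] e

  ∑-cong : ∀ {f g : A → ℕ} {xs} → All (λ x → f x ≡ g x) xs → ∑ xs f ≡ ∑ xs g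
  ∑-cong []            = refl
  ∑-cong (fx≡gx ∷ eqs) = cong₂ _+_ fx≡gx (∑-cong eqs)

  ∑-mono : ∀ {f g : A → ℕ} {xs} → All (λ x → f x ≤ g x) xs → ∑ xs f ≤ ∑ xs g
  ∑-mono []            = z≤n
  ∑-mono (fx≤gx ∷ les) = +-mono-≤ fx≤gx (∑-mono les)

  ∑-+ : ∀ (f g : A → ℕ) xs → ∑[ x ← xs ] (f x + g x) ≡ ∑ xs f + ∑ xs g
  ∑-+ f g []       = refl
  ∑-+ f g (x ∷ xs) = trans (cong (f x + g x +_) (∑-+ f g xs)) (interchange (f x) (g x) _ _)
    where
    interchange : ∀ a b c d → a + b + (c + d) ≡ a + c + (b + d)
    interchange = solve-∀

  ∑-*ˡ : ∀ k (f : A → ℕ) xs → ∑[ x ← xs ] (k * f x) ≡ k * ∑ xs f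
  ∑-*ˡ k f []       = sym (*-zeroʳ k)
  ∑-*ˡ k f (x ∷ xs) = trans (cong (k * f x +_) (∑-*ˡ k f xs)) (sym (*-distribˡ-+ k (f x) _))

  ∑-const : ∀ c (xs : List A) → ∑[ _ ← xs ] c ≡ length xs * c
  ∑-const c []       = refl
  ∑-const c (_ ∷ xs) = cong (c +_) (∑-const c xs)

  ∑-zero : ∀ (xs : List A) → ∑[ _ ← xs ] 0 ≡ 0
  ∑-zero xs = trans (∑-const 0 xs) (*-zeroʳ (length xs))

  ∑-swap : ∀ (f : A → B → ℕ) xs ys →
           ∑[ x ← xs ] ∑[ y ← ys ] f x y ≡ ∑[ y ← ys ] ∑[ x ← xs ] f x y
  ∑-swap f []       ys = sym (∑-zero ys)
  ∑-swap f (x ∷ xs) ys = trans (cong (∑ ys (f x) +_) (∑-swap f xs ys))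
                               (sym (∑-+ (f x) (λ y → ∑[ x ← xs ] f x y) ys))

  ∑-map : ∀ (f : B → ℕ) (h : A → B) xs → ∑ (map h xs) f ≡ ∑[ x ← xs ] f (h x)
  ∑-map f h []       = refl
  ∑-map f h (x ∷ xs) = cong (f (h x) +_) (∑-map f h xs)

  ∑-concatMap : ∀ (f : B → ℕ) (g : A → List B) xs →
                ∑ (concatMap g xs) f ≡ ∑[ x ← xs ] ∑[ y ← g x ] f y
  ∑-concatMap f g []       = refl
  ∑-concatMap f g (x ∷ xs) = begin
    sum (map f (g x ++ concatMap g xs))          ≡⟨ cong sum (map-++ f (g x) _) ⟩
    sum (map f (g x) ++ map f (concatMap g xs))  ≡⟨ sum-++ (map f (g x)) _ ⟩
    ∑ (g x) f + ∑ (concatMap g xs) f             ≡⟨ cong (∑ (g x) f +_) (∑-concatMap f g xs) ⟩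
    ∑ (g x) f + ∑[ x ← xs ] ∑[ y ← g x ] f y     ∎
    where open ≡-Reasoning

  δ : ℕ → ℕ → ℕ
  δ v x = if does (v ≟ x) then 1 else 0

  δ-refl : ∀ x → δ x x ≡ 1
  δ-refl x rewrite dec-true (x ≟ x) refl = refl

  δ-≢ : ∀ {v x} → v ≢ x → δ v x ≡ 0
  δ-≢ {v} {x} v≢x rewrite dec-false (v ≟ x) v≢x = refl

  ∑-δ-∉ : ∀ {x vs} → All (x ≢_) vs → ∑[ v ← vs ] δ v x ≡ 0
  ∑-δ-∉ []            = refl
  ∑-δ-∉ (x≢v ∷ x∉vs) = cong₂ _+_ (δ-≢ (x≢v ∘ sym)) (∑-δ-∉ x∉vs)

  ∑-δ-unique : ∀ {vs} → Unique vs → ∀ x → ∑[ v ← vs ] δ v x ≤ 1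
  ∑-δ-unique []               x = z≤n
  ∑-δ-unique {v ∷ vs} (v∉vs ∷ vs!) x with v ≟ x
  ... | yes refl = ≤-reflexive (cong₂ _+_ (δ-refl x) (∑-δ-∉ v∉vs))
  ... | no  v≢x  = subst (λ t → t + _ ≤ 1) (sym (δ-≢ v≢x)) (∑-δ-unique vs! x)

  occurrences : ℕ → List ℕ → ℕ
  occurrences v xs = ∑[ x ← xs ] δ v x

  occurrences-∈ : ∀ {x xs} → x ∈ xs → 1 ≤ occurrences x xs
  occurrences-∈ {x} (here refl) = ≤-trans (≤-reflexive (sym (δ-refl x))) (m≤m+n _ _)
  occurrences-∈ {x} {y ∷ _} (there x∈xs) = ≤-trans (occurrences-∈ x∈xs) (m≤n+m _ (δ x y))

  collisions : List ℕ → ℕ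
  collisions []       = 0
  collisions (x ∷ xs) = occurrences x xs + collisions xs

  length≤distinctCount+collisions : ∀ xs → length xs ≤ distinctCount xs + collisions xs
  length≤distinctCount+collisions []       = z≤n
  length≤distinctCount+collisions (x ∷ xs) with x ∈? xs
  ... | yes x∈xs = begin
    suc (length xs)                              ≤⟨ s≤s (length≤distinctCount+collisions xs) ⟩
    suc (distinctCount xs + collisions xs)       ≡⟨ +-suc _ _ ⟨
    distinctCount xs + (1 + collisions xs)       ≤⟨ +-mono-≤ (distinctCount-mono {xs} {x ∷ xs} there)
                                                             (+-monoˡ-≤ (collisions xs) (occurrences-∈ x∈xs)) ⟩
    distinctCount (x ∷ xs) + collisions (x ∷ xs) ∎
    where open ≤-Reasoning
  ... | no x∉xs = begin
    suc (length xs)                              ≤⟨ s≤s (length≤distinctCount+collisions xs) ⟩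
    suc (distinctCount xs) + collisions xs       ≡⟨ cong (_+ collisions xs) (distinctCount-∷-∉ x∉xs) ⟨
    distinctCount (x ∷ xs) + collisions xs       ≤⟨ +-monoʳ-≤ _ (m≤n+m (collisions xs) (occurrences x xs)) ⟩
    distinctCount (x ∷ xs) + collisions (x ∷ xs) ∎
    where open ≤-Reasoning

  fingerprint-head : ∀ x ids v vs → fingerprint (x ∷ ids) (v ∷ vs) x ≡ v
  fingerprint-head x ids v vs with x ≟ x
  ... | yes _   = refl
  ... | no  x≢x = ⊥-elim (x≢x refl)

  fingerprint-tail : ∀ {x y} ids v vs → x ≢ y →
                     fingerprint (x ∷ ids) (v ∷ vs) y ≡ fingerprint ids vs y
  fingerprint-tail {x} {y} ids v vs x≢y with x ≟ y
  ... | yes x≡y = ⊥-elim (x≢y x≡y)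
  ... | no  _   = refl

  fingerprint-onto : ∀ {ids vs} → Unique ids → length ids ≡ length vs →
                     ∀ {v} → v ∈ vs → ∃ λ y → y ∈ ids × fingerprint ids vs y ≡ v
  fingerprint-onto {x ∷ ids} {v ∷ vs} _ _ (here refl) = x , here refl , fingerprint-head x ids v vs
  fingerprint-onto {x ∷ ids} {v ∷ vs} (x∉ids ∷ ids!) len (there v∈vs)
    with y , y∈ids , fy≡v ← fingerprint-onto ids! (suc-injective len) v∈vs
    = y , there y∈ids , trans (fingerprint-tail ids v vs (All.lookup x∉ids y∈ids)) fy≡v

  module _ {W} (w : Vec ℕ W) (vs : List ℕ) where

    private
      h : ℕ → ℕ
      h = fingerprint (distinctIds w) vs

    Z≤D : Z w vs ≤ D w
    Z≤D = begin
      Z w vs                                ≤⟨ distinctCount-mono (⊆.map⁺ h toList⊆ids) ⟩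
      distinctCount (map h (distinctIds w)) ≤⟨ distinctCount≤length (map h (distinctIds w)) ⟩
      length (map h (distinctIds w))        ≡⟨ length-map h (distinctIds w) ⟩
      D w                                   ∎
      where
      open ≤-Reasoning
      toList⊆ids : toList w ⊆ distinctIds w
      toList⊆ids = ∈-deduplicate⁺ _≟_

    distinctCount≤Z : length vs ≡ D w → distinctCount vs ≤ Z w vs
    distinctCount≤Z len = distinctCount-mono {vs} vs⊆image
      where
      vs⊆image : vs ⊆ map h (toList w)
      vs⊆image v∈vs with y , y∈ids , hy≡v ← fingerprint-onto (deduplicate-! _≟_ (toList w)) (sym len) v∈vs
        = subst (_∈ map h (toList w)) hy≡v (∈-map⁺ h (∈-deduplicate⁻ _≟_ (toList w) y∈ids))

  square-bound : ∀ {z d c} → z ≤ d → d ≤ z + c → d ^ 2 ≤ z ^ 2 + 2 * d * c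
  square-bound {z} {d} {c} z≤d d≤z+c = begin
    d * (d * 1)               ≤⟨ *-monoʳ-≤ d (*-monoˡ-≤ 1 d≤z+c) ⟩
    d * ((z + c) * 1)         ≡⟨ expand d z c ⟩
    z * d + c * d             ≤⟨ +-monoˡ-≤ (c * d) (*-monoʳ-≤ z d≤z+c) ⟩
    z * (z + c) + c * d       ≡⟨ cong (_+ c * d) (*-distribˡ-+ z z c) ⟩
    z * z + z * c + c * d     ≤⟨ +-monoˡ-≤ (c * d) (+-monoʳ-≤ (z * z) (*-monoˡ-≤ c z≤d)) ⟩
    z * z + d * c + c * d     ≡⟨ collect z d c ⟩
    z * (z * 1) + 2 * d * c   ∎
    where
    open ≤-Reasoning
    expand : ∀ d z c → d * ((z + c) * 1) ≡ z * d + c * d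
    expand = solve-∀
    collect : ∀ z d c → z * z + d * c + c * d ≡ z * (z * 1) + 2 * d * c
    collect = solve-∀

  module _ (N : ℕ) where

    assignments-length : ∀ d → All (λ vs → length vs ≡ d) (assignments d N)
    assignments-length zero    = refl ∷ []
    assignments-length (suc d) =
      concat⁺ (map⁺ (All.universal (λ _ → map⁺ (All.map (cong suc) (assignments-length d))) (upTo N)))

    ∑-assignments-suc : ∀ d (F : List ℕ → ℕ) →
      ∑ (assignments (suc d) N) F ≡ ∑[ v ← upTo N ] ∑[ vs ← assignments d N ] F (v ∷ vs)
    ∑-assignments-suc d F = trans (∑-concatMap F (λ v → map (v ∷_) (assignments d N)) (upTo N))
      (∑-cong (All.universal (λ v → ∑-map F (v ∷_) (assignments d N)) (upTo N)))

    ∑-assignments-const : ∀ d c → ∑[ _ ← assignments d N ] c ≡ c * N ^ d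
    ∑-assignments-const zero    c = trans (+-identityʳ c) (sym (*-identityʳ c))
    ∑-assignments-const (suc d) c = begin
      ∑[ _ ← assignments (suc d) N ] c                ≡⟨ ∑-assignments-suc d (λ _ → c) ⟩
      ∑[ _ ← upTo N ] ∑[ _ ← assignments d N ] c      ≡⟨ ∑-cong (All.universal (λ _ → ∑-assignments-const d c) (upTo N)) ⟩
      ∑[ _ ← upTo N ] (c * N ^ d)                     ≡⟨ ∑-const (c * N ^ d) (upTo N) ⟩
      length (upTo N) * (c * N ^ d)                   ≡⟨ cong (_* (c * N ^ d)) (length-upTo N) ⟩
      N * (c * N ^ d)                                 ≡⟨ x*[y*z]≡y*[x*z] N c (N ^ d) ⟩
      c * N ^ suc d                                   ∎
      where
      open ≡-Reasoning
      x*[y*z]≡y*[x*z] : ∀ x y z → x * (y * z) ≡ y * (x * z)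
      x*[y*z]≡y*[x*z] = solve-∀

    ∑-occurrences≤length : ∀ xs → ∑[ v ← upTo N ] occurrences v xs ≤ length xs
    ∑-occurrences≤length xs = begin
      ∑[ v ← upTo N ] ∑[ x ← xs ] δ v x  ≡⟨ ∑-swap δ (upTo N) xs ⟩
      ∑[ x ← xs ] ∑[ v ← upTo N ] δ v x  ≤⟨ ∑-mono (All.universal (∑-δ-unique (upTo⁺ N)) xs) ⟩
      ∑[ _ ← xs ] 1                      ≡⟨ ∑-const 1 xs ⟩
      length xs * 1                      ≡⟨ *-identityʳ (length xs) ⟩
      length xs                          ∎
      where open ≤-Reasoning

    collisionSum : ℕ → ℕ
    collisionSum d = ∑[ vs ← assignments d N ] collisions vs

    collisionSum-suc : ∀ d → collisionSum (suc d) ≤ d * N ^ d + N * collisionSum d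
    collisionSum-suc d = begin
      collisionSum (suc d)
        ≡⟨ ∑-assignments-suc d collisions ⟩
      ∑[ v ← upTo N ] ∑[ vs ← 𝒜 ] (occurrences v vs + collisions vs)
        ≡⟨ ∑-cong (All.universal (λ v → ∑-+ (occurrences v) collisions 𝒜) (upTo N)) ⟩
      ∑[ v ← upTo N ] (∑[ vs ← 𝒜 ] occurrences v vs + collisionSum d)
        ≡⟨ ∑-+ (λ v → ∑[ vs ← 𝒜 ] occurrences v vs) (λ _ → collisionSum d) (upTo N) ⟩
      ∑[ v ← upTo N ] ∑[ vs ← 𝒜 ] occurrences v vs + ∑[ _ ← upTo N ] collisionSum d
        ≡⟨ cong₂ _+_ (∑-swap occurrences (upTo N) 𝒜)
                     (trans (∑-const (collisionSum d) (upTo N)) (cong (_* collisionSum d) (length-upTo N))) ⟩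
      ∑[ vs ← 𝒜 ] ∑[ v ← upTo N ] occurrences v vs + N * collisionSum d
        ≤⟨ +-monoˡ-≤ (N * collisionSum d) (∑-mono (All.universal ∑-occurrences≤length 𝒜)) ⟩
      ∑[ vs ← 𝒜 ] length vs + N * collisionSum d
        ≡⟨ cong (_+ N * collisionSum d) (trans (∑-cong (assignments-length d)) (∑-assignments-const d d)) ⟩
      d * N ^ d + N * collisionSum d
        ∎
      where
      open ≤-Reasoning
      𝒜 : List (List ℕ)
      𝒜 = assignments d N

    collisionSum-bound : ∀ k → 2 * collisionSum (suc k) ≤ suc k * k * N ^ k
    collisionSum-bound zero    = *-monoʳ-≤ 2 (≤-trans (collisionSum-suc zero) (≤-reflexive (*-zeroʳ N)))
    collisionSum-bound (suc k) = begin
      2 * collisionSum (suc (suc k))                           ≤⟨ *-monoʳ-≤ 2 (collisionSum-suc (suc k)) ⟩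
      2 * (suc k * N ^ suc k + N * collisionSum (suc k))       ≡⟨ regroup (suc k) N (N ^ suc k) (collisionSum (suc k)) ⟩
      2 * (suc k * N ^ suc k) + N * (2 * collisionSum (suc k)) ≤⟨ +-monoʳ-≤ _ (*-monoʳ-≤ N (collisionSum-bound k)) ⟩
      2 * (suc k * N ^ suc k) + N * (suc k * k * N ^ k)        ≡⟨ collect k N (N ^ k) ⟩
      suc (suc k) * suc k * N ^ suc k                          ∎
      where
      open ≤-Reasoning
      regroup : ∀ d N M T → 2 * (d * M + N * T) ≡ 2 * (d * M) + N * (2 * T)
      regroup = solve-∀
      collect : ∀ k N P → 2 * (suc k * (N * P)) + N * (suc k * k * P) ≡ suc (suc k) * suc k * (N * P)
      collect = solve-∀

  module _ {W} (w : Vec ℕ W) (N : ℕ) where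

    ∑Z² : ℕ
    ∑Z² = ∑[ vs ← assignments (D w) N ] Z w vs ^ 2

    ∑Z²≤D²N^D : ∑Z² ≤ D w ^ 2 * N ^ D w
    ∑Z²≤D²N^D = begin
      ∑[ vs ← assignments (D w) N ] Z w vs ^ 2 ≤⟨ ∑-mono (All.universal (λ vs → ^-monoˡ-≤ 2 (Z≤D w vs)) (assignments (D w) N)) ⟩
      ∑[ _ ← assignments (D w) N ] D w ^ 2     ≡⟨ ∑-assignments-const N (D w) (D w ^ 2) ⟩
      D w ^ 2 * N ^ D w                        ∎
      where open ≤-Reasoning

    D²N^D≤∑Z²+collisions : D w ^ 2 * N ^ D w ≤ ∑Z² + 2 * D w * collisionSum N (D w)
    D²N^D≤∑Z²+collisions = begin
      D w ^ 2 * N ^ D w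
        ≡⟨ ∑-assignments-const N (D w) (D w ^ 2) ⟨
      ∑[ _ ← 𝒜 ] D w ^ 2
        ≤⟨ ∑-mono (All.map Z²-bound (assignments-length N (D w))) ⟩
      ∑[ vs ← 𝒜 ] (Z w vs ^ 2 + 2 * D w * collisions vs)
        ≡⟨ ∑-+ (λ vs → Z w vs ^ 2) (λ vs → 2 * D w * collisions vs) 𝒜 ⟩
      ∑[ vs ← 𝒜 ] Z w vs ^ 2 + ∑[ vs ← 𝒜 ] 2 * D w * collisions vs
        ≡⟨ cong (∑[ vs ← 𝒜 ] Z w vs ^ 2 +_) (∑-*ˡ (2 * D w) collisions 𝒜) ⟩
      ∑[ vs ← 𝒜 ] Z w vs ^ 2 + 2 * D w * collisionSum N (D w)
        ∎
      where
      open ≤-Reasoning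
      𝒜 : List (List ℕ)
      𝒜 = assignments (D w) N
      Z²-bound : ∀ {vs} → length vs ≡ D w → D w ^ 2 ≤ Z w vs ^ 2 + 2 * D w * collisions vs
      Z²-bound {vs} len = square-bound (Z≤D w vs) (begin
        D w                              ≡⟨ len ⟨
        length vs                        ≤⟨ length≤distinctCount+collisions vs ⟩
        distinctCount vs + collisions vs ≤⟨ +-monoˡ-≤ (collisions vs) (distinctCount≤Z w vs len) ⟩
        Z w vs + collisions vs           ∎)

  cross-multiplied-lower : ∀ {N} .{{_ : NonZero N}} k S T → let d = suc k in
    d ^ 2 * N ^ d ≤ S + 2 * d * T → 2 * T ≤ d * k * N ^ k →
    3 * N * d ^ 2 * N ^ d < 3 * N * S + 4 * d ^ 3 * N ^ d
  cross-multiplied-lower {N} k S T d²M≤S+2dT 2T≤dkP = begin-strict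
    3 * N * d ^ 2 * M               ≡⟨ *-assoc (3 * N) (d ^ 2) M ⟩
    3 * N * (d ^ 2 * M)             ≤⟨ *-monoʳ-≤ (3 * N) d²M≤S+2dT ⟩
    3 * N * (S + 2 * d * T)         ≡⟨ expand N S d T ⟩
    3 * N * S + 3 * d * N * (2 * T) ≤⟨ +-monoʳ-≤ (3 * N * S) (*-monoʳ-≤ (3 * d * N) 2T≤dkP) ⟩
    3 * N * S + 3 * d * N * (d * k * N ^ k) ≡⟨ cong (3 * N * S +_) (regroup N d k (N ^ k)) ⟩
    3 * N * S + 3 * k * (d ^ 2 * M) <⟨ +-monoʳ-< (3 * N * S) (*-monoˡ-< (d ^ 2 * M) 3k<4d) ⟩
    3 * N * S + 4 * d * (d ^ 2 * M) ≡⟨ cong (3 * N * S +_) (cube d M) ⟩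
    3 * N * S + 4 * d ^ 3 * M       ∎
    where
    open ≤-Reasoning
    d M : ℕ
    d = suc k
    M = N ^ d
    instance
      d²M≢0 : NonZero (d ^ 2 * M)
      d²M≢0 = m*n≢0 (d ^ 2) M {{m^n≢0 d 2}} {{m^n≢0 N d}}
    3k<4d : 3 * k < 4 * d
    3k<4d = subst (3 * k <_) (add k) (m<m+n (3 * k) {4 + k} z<s)
      where
      add : ∀ k → 3 * k + (4 + k) ≡ 4 * suc k
      add = solve-∀
    expand : ∀ N S d T → 3 * N * (S + 2 * d * T) ≡ 3 * N * S + 3 * d * N * (2 * T)
    expand = solve-∀
    regroup : ∀ N d k P → 3 * d * N * (d * k * P) ≡ 3 * k * (d * (d * 1) * (N * P))
    regroup = solve-∀
    cube : ∀ d M → 4 * d * (d * (d * 1) * M) ≡ 4 * (d * (d * (d * 1))) * M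
    cube = solve-∀

module Fractions where

  open import Data.Nat as ℕ using (ℕ; suc; NonZero)
  import Data.Nat.Properties as ℕ
  open import Data.Integer as ℤ using (ℤ; +_; +<+)
  import Data.Integer.Properties as ℤ
  open import Data.Integer.Tactic.RingSolver using (solve-∀)
  open import Data.Rational using (_/_; _+_; _-_; _*_; -_; _<_; toℚᵘ)
  open import Data.Rational.Properties using (toℚᵘ-fromℚᵘ; toℚᵘ-homo-+; toℚᵘ-homo-*; toℚᵘ-homo‿-; toℚᵘ-cancel-<)
  open import Data.Rational.Unnormalised as ℚᵘ using (mkℚᵘ; *<*; _≃_)
  import Data.Rational.Unnormalised.Properties as ℚᵘ
  open import Relation.Binary.PropositionalEquality

  toℚᵘ-/ : ∀ i n .{{_ : NonZero n}} → toℚᵘ (i / n) ≃ i ℚᵘ./ n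
  toℚᵘ-/ i (suc n) = toℚᵘ-fromℚᵘ (mkℚᵘ i n)

  toℚᵘ-homo-- : ∀ p q → toℚᵘ (p - q) ≃ toℚᵘ p ℚᵘ.- toℚᵘ q
  toℚᵘ-homo-- p q = ℚᵘ.≃-trans (toℚᵘ-homo-+ p (- q)) (ℚᵘ.+-congʳ (toℚᵘ p) (toℚᵘ-homo‿- q))

  pos-*-* : ∀ x y z → + (x ℕ.* y ℕ.* z) ≡ + x ℤ.* + y ℤ.* + z
  pos-*-* x y z = trans (ℤ.pos-* (x ℕ.* y) z) (cong (ℤ._* + z) (ℤ.pos-* x y))

  fraction-lower : ∀ a c q b n s m .{{_ : NonZero q}} .{{_ : NonZero n}} .{{_ : NonZero m}} →
    q ℕ.* n ℕ.* a ℕ.* m ℕ.< q ℕ.* n ℕ.* s ℕ.+ c ℕ.* b ℕ.* m →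
    (+ a / 1) - (+ c / q) * (+ b / n) < + s / m
  fraction-lower a c q@(suc _) b n@(suc _) s m@(suc _) ineq = toℚᵘ-cancel-< unnormalised
    where
    image : toℚᵘ ((+ a / 1) - (+ c / q) * (+ b / n)) ≃ (+ a ℚᵘ./ 1) ℚᵘ.- (+ c ℚᵘ./ q) ℚᵘ.* (+ b ℚᵘ./ n)
    image = ℚᵘ.≃-trans (toℚᵘ-homo-- (+ a / 1) _)
      (ℚᵘ.+-cong (toℚᵘ-/ (+ a) 1) (ℚᵘ.-‿cong (ℚᵘ.≃-trans (toℚᵘ-homo-* (+ c / q) _) (ℚᵘ.*-cong (toℚᵘ-/ (+ c) q) (toℚᵘ-/ (+ b) n)))))
    Q CBM : ℤ
    Q   = + (q ℕ.* n)
    CBM = + c ℤ.* + b ℤ.* + m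
    -- ↥ p * ↧ q < ↥ q * ↧ p, with numerators and denominators as ℚᵘ arithmetic computes them
    cross : (+ a ℤ.* Q ℤ.+ ℤ.- (+ c ℤ.* + b) ℤ.* + 1) ℤ.* + m ℤ.< + s ℤ.* + (1 ℕ.* (q ℕ.* n))
    cross = begin-strict
      (+ a ℤ.* Q ℤ.+ ℤ.- (+ c ℤ.* + b) ℤ.* + 1) ℤ.* + m ≡⟨ regroup Q (+ a) (+ c) (+ b) (+ m) ⟩
      Q ℤ.* + a ℤ.* + m ℤ.- CBM                         ≡⟨ cong (ℤ._- CBM) (pos-*-* (q ℕ.* n) a m) ⟨
      + (q ℕ.* n ℕ.* a ℕ.* m) ℤ.- CBM                   <⟨ ℤ.+-monoˡ-< (ℤ.- CBM) (+<+ ineq) ⟩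
      + (q ℕ.* n ℕ.* s ℕ.+ c ℕ.* b ℕ.* m) ℤ.- CBM       ≡⟨ cong (ℤ._- CBM) (ℤ.pos-+ (q ℕ.* n ℕ.* s) (c ℕ.* b ℕ.* m)) ⟩
      + (q ℕ.* n ℕ.* s) ℤ.+ + (c ℕ.* b ℕ.* m) ℤ.- CBM   ≡⟨ cong₂ (λ x y → x ℤ.+ y ℤ.- CBM) (ℤ.pos-* (q ℕ.* n) s) (pos-*-* c b m) ⟩
      Q ℤ.* + s ℤ.+ CBM ℤ.- CBM                         ≡⟨ cancel Q (+ s) CBM ⟩
      + s ℤ.* Q                                         ≡⟨ cong (λ t → + s ℤ.* + t) (ℕ.*-identityˡ (q ℕ.* n)) ⟨
      + s ℤ.* + (1 ℕ.* (q ℕ.* n))                       ∎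
      where
      open ℤ.≤-Reasoning
      regroup : ∀ Q A C B M → (A ℤ.* Q ℤ.+ ℤ.- (C ℤ.* B) ℤ.* + 1) ℤ.* M ≡ Q ℤ.* A ℤ.* M ℤ.- C ℤ.* B ℤ.* M
      regroup = solve-∀
      cancel : ∀ Q S X → Q ℤ.* S ℤ.+ X ℤ.- X ≡ S ℤ.* Q
      cancel = solve-∀
    unnormalised : toℚᵘ ((+ a / 1) - (+ c / q) * (+ b / n)) ℚᵘ.< toℚᵘ (+ s / m)
    unnormalised = begin-strict
      toℚᵘ ((+ a / 1) - (+ c / q) * (+ b / n))         ≃⟨ image ⟩
      (+ a ℚᵘ./ 1) ℚᵘ.- (+ c ℚᵘ./ q) ℚᵘ.* (+ b ℚᵘ./ n) <⟨ *<* cross ⟩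
      + s ℚᵘ./ m                                       ≃⟨ toℚᵘ-/ (+ s) m ⟨
      toℚᵘ (+ s / m)                                   ∎
      where open ℚᵘ.≤-Reasoning

  fraction-upper : ∀ a c q b n s m .{{_ : NonZero q}} .{{_ : NonZero n}} .{{_ : NonZero m}} →
    .{{_ : NonZero c}} .{{_ : NonZero b}} →
    s ℕ.≤ a ℕ.* m → + s / m < (+ a / 1) + (+ c / q) * (+ b / n)
  fraction-upper a c q@(suc _) b n@(suc _) s m@(suc _) s≤am = toℚᵘ-cancel-< unnormalised
    where
    image : toℚᵘ ((+ a / 1) + (+ c / q) * (+ b / n)) ≃ (+ a ℚᵘ./ 1) ℚᵘ.+ (+ c ℚᵘ./ q) ℚᵘ.* (+ b ℚᵘ./ n)
    image = ℚᵘ.≃-trans (toℚᵘ-homo-+ (+ a / 1) _)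
      (ℚᵘ.+-cong (toℚᵘ-/ (+ a) 1) (ℚᵘ.≃-trans (toℚᵘ-homo-* (+ c / q) _) (ℚᵘ.*-cong (toℚᵘ-/ (+ c) q) (toℚᵘ-/ (+ b) n))))
    Q CBM : ℤ
    Q   = + (q ℕ.* n)
    CBM = + c ℤ.* + b ℤ.* + m
    ineq : q ℕ.* n ℕ.* s ℕ.< q ℕ.* n ℕ.* a ℕ.* m ℕ.+ c ℕ.* b ℕ.* m
    ineq = ℕ.≤-<-trans (ℕ.≤-trans (ℕ.*-monoʳ-≤ (q ℕ.* n) s≤am) (ℕ.≤-reflexive (sym (ℕ.*-assoc (q ℕ.* n) a m))))
                       (ℕ.m<m+n _ (ℕ.>-nonZero⁻¹ (c ℕ.* b ℕ.* m) {{ℕ.m*n≢0 (c ℕ.* b) m {{ℕ.m*n≢0 c b}}}}))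
    cross : + s ℤ.* + (1 ℕ.* (q ℕ.* n)) ℤ.< (+ a ℤ.* Q ℤ.+ (+ c ℤ.* + b) ℤ.* + 1) ℤ.* + m
    cross = begin-strict
      + s ℤ.* + (1 ℕ.* (q ℕ.* n))                   ≡⟨ cong (λ t → + s ℤ.* + t) (ℕ.*-identityˡ (q ℕ.* n)) ⟩
      + s ℤ.* Q                                     ≡⟨ ℤ.*-comm (+ s) Q ⟩
      Q ℤ.* + s                                     ≡⟨ ℤ.pos-* (q ℕ.* n) s ⟨
      + (q ℕ.* n ℕ.* s)                             <⟨ +<+ ineq ⟩
      + (q ℕ.* n ℕ.* a ℕ.* m ℕ.+ c ℕ.* b ℕ.* m)     ≡⟨ ℤ.pos-+ (q ℕ.* n ℕ.* a ℕ.* m) (c ℕ.* b ℕ.* m) ⟩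
      + (q ℕ.* n ℕ.* a ℕ.* m) ℤ.+ + (c ℕ.* b ℕ.* m) ≡⟨ cong₂ ℤ._+_ (pos-*-* (q ℕ.* n) a m) (pos-*-* c b m) ⟩
      Q ℤ.* + a ℤ.* + m ℤ.+ CBM                     ≡⟨ regroup Q (+ a) (+ c) (+ b) (+ m) ⟩
      (+ a ℤ.* Q ℤ.+ (+ c ℤ.* + b) ℤ.* + 1) ℤ.* + m ∎
      where
      open ℤ.≤-Reasoning
      regroup : ∀ Q A C B M → Q ℤ.* A ℤ.* M ℤ.+ C ℤ.* B ℤ.* M ≡ (A ℤ.* Q ℤ.+ (C ℤ.* B) ℤ.* + 1) ℤ.* M
      regroup = solve-∀
    unnormalised : toℚᵘ (+ s / m) ℚᵘ.< toℚᵘ ((+ a / 1) + (+ c / q) * (+ b / n))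
    unnormalised = begin-strict
      toℚᵘ (+ s / m)                                   ≃⟨ toℚᵘ-/ (+ s) m ⟩
      + s ℚᵘ./ m                                       <⟨ *<* cross ⟩
      (+ a ℚᵘ./ 1) ℚᵘ.+ (+ c ℚᵘ./ q) ℚᵘ.* (+ b ℚᵘ./ n) ≃⟨ image ⟨
      toℚᵘ ((+ a / 1) + (+ c / q) * (+ b / n))         ∎
      where open ℚᵘ.≤-Reasoning

open import Defs
open import Data.Nat using (ℕ; _≤_; _<_; _^_; suc; pred; NonZero)
open import Data.Nat.Properties using (m^n≢0)
open import Data.Vec using (Vec; _∷_)
open import Data.Product using (_×_; _,_)
open import Data.Integer using (+_)
open import Data.Rational using (ℚ; _/_; _+_; _-_; _*_) renaming (_<_ to _<ℚ_)
open Counting using (∑Z²; ∑Z²≤D²N^D; D²N^D≤∑Z²+collisions; collisionSum; collisionSum-bound; cross-multiplied-lower)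
open Fractions using (fraction-lower; fraction-upper)

-- D of a nonempty window reduces to a successor,
-- so suc (pred d) is d definitionally.
corollary14 : (W L : ℕ) → 1 ≤ W → W < 2 ^ L → (window : Vec ℕ W) →
    ((((+ (D window ^ 2)) / 1) - ((+ 4) / 3) * ((D window ^ 3) over2^ L)) <ℚ EZ² L window)
    × (EZ² L window <ℚ (((+ (D window ^ 2)) / 1) + ((+ 1) / 3) * ((D window ^ 3) over2^ L)))
corollary14 (suc _) L _ _ window@(_ ∷ _) =
    fraction-lower (d ^ 2) 4 3 (d ^ 3) N S (N ^ d)
      (cross-multiplied-lower (pred d) S (collisionSum N d)
        (D²N^D≤∑Z²+collisions window N) (collisionSum-bound N (pred d)))
  , fraction-upper (d ^ 2) 1 3 (d ^ 3) N S (N ^ d) (∑Z²≤D²N^D window N)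
  where
  N d S : ℕ
  N = 2 ^ L
  d = D window
  S = ∑Z² window N
  instance
    N≢0 : NonZero N
    N≢0 = m^n≢0 2 L
    N^d≢0 : NonZero (N ^ d)
    N^d≢0 = m^n≢0 N d
    d³≢0 : NonZero (d ^ 3)
    d³≢0 = m^n≢0 d 3
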